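{- Let $G$ be a graph, $u,v$ distinct non-adjacent vertices, $k$ a positive integer, and $S_a,S_b$ two $uv$-separators with $|S_a|,|S_b|\le k$ such that it is not the case that ($S_a\ne S_b$ and at least one of $S_a,S_b$ is a minimal $uv$-separator with exactly $k$ vertices). Let $S_a'$ be a set of cardinality $k-1$ such that $S_a'\cap S_a$ contains a $uv$-separator, and let $S_b'$ be a set of cardinality $k-1$ such that $S_b'\cap S_b$ contains a $uv$-separator. Then the answers to $TAR(G,S_a,S_b,k)$, $TAR(G,S_a',S_b',k)$ and $TJ(G,S_a',S_b')$ coincide, and $\mathrm{dist}_{TJ}(G,S_a',S_b')=\mathrm{dist}_{k\text{ - }TAR}(G,S_a',S_b')/2$.
   Context: A set $S\subseteq V(G)\setminus\{u,v\}$ is a $uv$-separator if $u$ and $v$ lie in different components of $G-S$; it is minimal if no proper subset is a $uv$-separator. TJ: separators $S,S'$ adjacent if $|S|=|S'|$ and $|S\setminus S'|=|S'\setminus S|=1$. $k$-TAR: $S,S'$ adjacent if $|S\triangle S'|=1$ and $\max(|S|,|S'|)\le k$. $TJ(G,S_a,S_b)$ / $TAR(G,S_a,S_b,k)$ asks whether a sequence of $uv$-separators from $S_a$ to $S_b$ with consecutive sets adjacent under the rule exists. $\mathrm{dist}_X$ is the minimum number of steps of such a sequence under rule $X$. -}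

module Defs where

open import Data.Nat using (ℕ; zero; suc; _+_; _*_; _≤_; _⊔_)
open import Data.Bool using (Bool; true; false)
open import Data.Fin using (Fin)
open import Data.Fin.Subset using (Subset; _∈_; _∉_; _⊆_; _⊂_; _∪_; _─_; ∣_∣)
open import Data.Product using (_×_; ∃)
open import Relation.Nullary using (¬_)
open import Relation.Binary.PropositionalEquality using (_≡_)

record Graph (n : ℕ) : Set where
  field
    adj    : Fin n → Fin n → Bool
    sym    : ∀ x y → adj x y ≡ adj y x
    irrefl : ∀ x → adj x x ≡ false

module _ {n : ℕ} (G : Graph n) where
  open Graph G

  Adjacent : Fin n → Fin n → Set
  Adjacent x y = adj x y ≡ true

  -- y is reachable from x in G - S by a walk whose vertices all lie outside S
  -- (x itself is required to be outside S by the callers).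
  data Reach (S : Subset n) (x : Fin n) : Fin n → Set where
    here : Reach S x x
    step : ∀ {y z} → Reach S x y → Adjacent y z → z ∉ S → Reach S x z

  IsSeparator : Fin n → Fin n → Subset n → Set
  IsSeparator u v S = u ∉ S × v ∉ S × ¬ Reach S u v

  IsMinimalSeparator : Fin n → Fin n → Subset n → Set
  IsMinimalSeparator u v S =
    IsSeparator u v S × (∀ T → T ⊂ S → ¬ IsSeparator u v T)

_△_ : ∀ {n} → Subset n → Subset n → Subset n
S △ S' = (S ─ S') ∪ (S' ─ S)

TJAdj : ∀ {n} → Subset n → Subset n → Set
TJAdj S S' = ∣ S ∣ ≡ ∣ S' ∣ × ∣ S ─ S' ∣ ≡ 1 × ∣ S' ─ S ∣ ≡ 1

TARAdj : ∀ {n} → ℕ → Subset n → Subset n → Set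
TARAdj k S S' = ∣ S △ S' ∣ ≡ 1 × (∣ S ∣ ⊔ ∣ S' ∣) ≤ k

data Steps {n : ℕ} (P : Subset n → Set) (R : Subset n → Subset n → Set)
     : Subset n → Subset n → ℕ → Set where
  done : ∀ {A} → P A → Steps P R A A 0
  move : ∀ {A B C m} → P A → R A B → Steps P R B C m → Steps P R A C (suc m)

Reconf : ∀ {n} → (Subset n → Set) → (Subset n → Subset n → Set) →
         Subset n → Subset n → Set
Reconf P R A B = ∃ λ m → Steps P R A B m

IsDist : ∀ {n} → (Subset n → Set) → (Subset n → Subset n → Set) →
         Subset n → Subset n → ℕ → Set
IsDist P R A B d = Steps P R A B d × (∀ m → Steps P R A B m → d ≤ m)

module _ {n : ℕ} (G : Graph n) (u v : Fin n) where

  TJ : Subset n → Subset n → Set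
  TJ = Reconf (IsSeparator G u v) TJAdj

  TAR : Subset n → Subset n → ℕ → Set
  TAR A B k = Reconf (IsSeparator G u v) (TARAdj k) A B

  IsDistTJ : Subset n → Subset n → ℕ → Set
  IsDistTJ = IsDist (IsSeparator G u v) TJAdj

  IsDistTAR : ℕ → Subset n → Subset n → ℕ → Set
  IsDistTAR k = IsDist (IsSeparator G u v) (TARAdj k)

-- Write K = k - 1.  The proof has three ingredients.
--
--  * Any two separators X, Y of size ≤ k containing a common separator T
--    are k-TAR-connected: delete X ∖ T one element at a time, then add
--    Y ∖ T (every intermediate set lies between T and a separator, hence is
--    a separator).  This transfers TAR-reachability from Sa, Sb to Sa', Sb'.
--  * A TJ step C → C' between sets of size K is simulated by the two TAR
--    steps C → C ∪ C' → C', whose middle set has size K + 1 = k.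
--  * Conversely, a k-TAR sequence of length m from A to B (|A| = |B| = K)
--    is simulated by a TJ sequence C₀ = A, C₁, … that always contains the
--    current TAR set S.  Only an addition of x ∉ C costs a TJ step
--    (exchange x with some y ∈ C ∖ S, or, if S = C, with the element y that
--    the next TAR step must delete); the invariant 2e + |S| ≤ m + K shows
--    that the TJ sequence has at most m / 2 steps.
--
-- The distance statements then follow from a general fact about doubling.
-- The hypotheses u ≢ v, ¬ adj(u, v) and the minimality condition on Sa, Sb
-- only serve to guarantee that sets Sa', Sb' as above exist; the argument
-- itself does not use them.

module Submission where

open import Defs
open import Data.Nat using (ℕ; _≤_; _*_; _∸_)
open import Data.Fin using (Fin)
open import Data.Fin.Subset using (Subset; _∉_; _⊆_; _∩_; ∣_∣)
open import Data.Product using (_×_; ∃)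
open import Data.Sum using (_⊎_)
open import Function.Bundles using (_⇔_)
open import Relation.Nullary using (¬_)
open import Relation.Binary.PropositionalEquality using (_≡_; _≢_)

open import Data.Nat using (zero; suc; _+_; _≟_; s≤s)
open import Data.Nat.Properties
  using ( suc-injective; n≤1+n; ≤-trans; ≤-reflexive; ≤-antisym; m≤n⇒m≤1+n; <-irrefl
        ; +-suc; +-comm; +-monoʳ-≤; +-cancelʳ-≤; *-suc; *-monoʳ-≤; *-cancelˡ-≤
        ; ⊔-lub; ⊔-comm; m≤n⊔m; 1+n≢0; 1+n≢n; 1+n≰n)
open import Data.Bool using (true; false)
open import Data.Fin using (zero; suc)
open import Data.Fin.Properties using (any?) renaming (_≟_ to _≟ᶠ_)
open import Data.Fin.Subset using (_∈_; _∪_; _─_; ⁅_⁆; _⊂_)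
open import Data.Fin.Subset.Properties
  using ( _∈?_; x∈p∪q⁻; x∈p∩q⁻; p⊆p∪q; p⊆q⇒∣p∣≤∣q∣; p⊂q⇒∣p∣<∣q∣; ⊆-trans
        ; ⊆-antisym; x∈⁅x⁆; x∈⁅y⁆⇒x≡y; x∈p∧x∉q⇒x∈p─q; p─q⊆p; ∣⁅x⁆∣≡1)
open import Data.Vec using ([]; _∷_; here; there; _[_]≔_)
open import Data.Vec.Properties using (lookup∘update; lookup∘update′; []=⇒lookup; lookup⇒[]=)
open import Data.Product using (_,_; proj₁; proj₂)
open import Data.Sum using (inj₁; inj₂)
open import Data.Empty using (⊥-elim)
open import Function using (_∘_)
open import Function.Bundles using (mk⇔)
open import Relation.Nullary using (yes; no; ¬?)
open import Relation.Nullary.Decidable using (_×-dec_; decidable-stable)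
open import Relation.Binary.PropositionalEquality using (refl; sym; trans; cong; cong₂; subst)

insert : ∀ {n} → Fin n → Subset n → Subset n
insert x p = p [ x ]≔ true

delete : ∀ {n} → Fin n → Subset n → Subset n
delete x p = p [ x ]≔ false

x∈insert : ∀ {n} (x : Fin n) p → x ∈ insert x p
x∈insert x p = lookup⇒[]= x _ (lookup∘update x p true)

x∉delete : ∀ {n} (x : Fin n) p → x ∉ delete x p
x∉delete x p x∈ with trans (sym (lookup∘update x p false)) ([]=⇒lookup x∈)
... | ()

∈-update⁺ : ∀ {n} {x z : Fin n} p b → z ≢ x → z ∈ p → z ∈ p [ x ]≔ b
∈-update⁺ p b z≢x z∈p =
  lookup⇒[]= _ _ (trans (lookup∘update′ z≢x p b) ([]=⇒lookup z∈p))

∈-update⁻ : ∀ {n} {x z : Fin n} p b → z ≢ x → z ∈ p [ x ]≔ b → z ∈ p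
∈-update⁻ p b z≢x z∈ =
  lookup⇒[]= _ _ (trans (sym (lookup∘update′ z≢x p b)) ([]=⇒lookup z∈))

∈-insert⁻ : ∀ {n} {x z : Fin n} p → z ∈ insert x p → z ≡ x ⊎ z ∈ p
∈-insert⁻ {x = x} {z} p z∈ with z ≟ᶠ x
... | yes z≡x = inj₁ z≡x
... | no z≢x = inj₂ (∈-update⁻ p true z≢x z∈)

∈-delete⁻ : ∀ {n} {x z : Fin n} p → z ∈ delete x p → z ≢ x × z ∈ p
∈-delete⁻ {x = x} {z} p z∈ with z ≟ᶠ x
... | yes refl = ⊥-elim (x∉delete x p z∈)
... | no z≢x = z≢x , ∈-update⁻ p false z≢x z∈

delete⊆ : ∀ {n} (x : Fin n) p → delete x p ⊆ p
delete⊆ x p = proj₂ ∘ ∈-delete⁻ p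

⊆insert : ∀ {n} (x : Fin n) p → p ⊆ insert x p
⊆insert x p {z} z∈p with z ≟ᶠ x
... | yes refl = x∈insert x p
... | no z≢x = ∈-update⁺ p true z≢x z∈p

insert-⊆ : ∀ {n} {x : Fin n} {p q} → x ∈ q → p ⊆ q → insert x p ⊆ q
insert-⊆ {p = p} x∈q p⊆q z∈ with ∈-insert⁻ p z∈
... | inj₁ refl = x∈q
... | inj₂ z∈p  = p⊆q z∈p

∣insert∣ : ∀ {n} (x : Fin n) p → x ∉ p → ∣ insert x p ∣ ≡ suc ∣ p ∣
∣insert∣ zero    (false ∷ p) _   = refl
∣insert∣ zero    (true ∷ p)  x∉p = ⊥-elim (x∉p here)
∣insert∣ (suc x) (false ∷ p) x∉p = ∣insert∣ x p (x∉p ∘ there)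
∣insert∣ (suc x) (true ∷ p)  x∉p = cong suc (∣insert∣ x p (x∉p ∘ there))

∣delete∣ : ∀ {n} (x : Fin n) p → x ∈ p → ∣ p ∣ ≡ suc ∣ delete x p ∣
∣delete∣ zero    (true ∷ p)  here        = refl
∣delete∣ (suc x) (false ∷ p) (there x∈p) = ∣delete∣ x p x∈p
∣delete∣ (suc x) (true ∷ p)  (there x∈p) = cong suc (∣delete∣ x p x∈p)

∣p△p∣≡0 : ∀ {n} (p : Subset n) → ∣ p △ p ∣ ≡ 0
∣p△p∣≡0 []          = refl
∣p△p∣≡0 (false ∷ p) = ∣p△p∣≡0 p
∣p△p∣≡0 (true ∷ p)  = ∣p△p∣≡0 p

∣p△q∣≡0⇒p≡q : ∀ {n} (p q : Subset n) → ∣ p △ q ∣ ≡ 0 → p ≡ q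
∣p△q∣≡0⇒p≡q []          []          _  = refl
∣p△q∣≡0⇒p≡q (false ∷ p) (false ∷ q) eq = cong (false ∷_) (∣p△q∣≡0⇒p≡q p q eq)
∣p△q∣≡0⇒p≡q (true ∷ p)  (true ∷ q)  eq = cong (true ∷_) (∣p△q∣≡0⇒p≡q p q eq)
∣p△q∣≡0⇒p≡q (false ∷ p) (true ∷ q)  ()
∣p△q∣≡0⇒p≡q (true ∷ p)  (false ∷ q) ()

△-comm : ∀ {n} (p q : Subset n) → p △ q ≡ q △ p
△-comm []          []          = refl
△-comm (false ∷ p) (false ∷ q) = cong (false ∷_) (△-comm p q)
△-comm (false ∷ p) (true ∷ q)  = cong (true ∷_) (△-comm p q)
△-comm (true ∷ p)  (false ∷ q) = cong (true ∷_) (△-comm p q)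
△-comm (true ∷ p)  (true ∷ q)  = cong (false ∷_) (△-comm p q)

∣p△delete∣ : ∀ {n} (x : Fin n) p → x ∈ p → ∣ p △ delete x p ∣ ≡ 1
∣p△delete∣ zero    (true ∷ p)  here        = cong suc (∣p△p∣≡0 p)
∣p△delete∣ (suc x) (false ∷ p) (there x∈p) = ∣p△delete∣ x p x∈p
∣p△delete∣ (suc x) (true ∷ p)  (there x∈p) = ∣p△delete∣ x p x∈p

data Flip {n} (p : Subset n) : Subset n → Set where
  added   : ∀ x → x ∉ p → Flip p (insert x p)
  removed : ∀ x → x ∈ p → Flip p (delete x p)

flip-∷ : ∀ {n} b {p q : Subset n} → Flip p q → Flip (b ∷ p) (b ∷ q)
flip-∷ b (added x x∉p)   = added (suc x) λ { (there x∈p) → x∉p x∈p }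
flip-∷ b (removed x x∈p) = removed (suc x) (there x∈p)

flip : ∀ {n} (p q : Subset n) → ∣ p △ q ∣ ≡ 1 → Flip p q
flip []          []          ()
flip (false ∷ p) (false ∷ q) eq = flip-∷ false (flip p q eq)
flip (true ∷ p)  (true ∷ q)  eq = flip-∷ true (flip p q eq)
flip (false ∷ p) (true ∷ q)  eq with ∣p△q∣≡0⇒p≡q p q (suc-injective eq)
... | refl = added zero λ ()
flip (true ∷ p)  (false ∷ q) eq with ∣p△q∣≡0⇒p≡q p q (suc-injective eq)
... | refl = removed zero here

∣p∪q∣ : ∀ {n} (p q : Subset n) → ∣ p ∪ q ∣ ≡ ∣ p ∣ + ∣ q ─ p ∣
∣p∪q∣ []          []          = refl
∣p∪q∣ (false ∷ p) (false ∷ q) = ∣p∪q∣ p q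
∣p∪q∣ (false ∷ p) (true ∷ q)  = trans (cong suc (∣p∪q∣ p q)) (sym (+-suc _ _))
∣p∪q∣ (true ∷ p)  (false ∷ q) = cong suc (∣p∪q∣ p q)
∣p∪q∣ (true ∷ p)  (true ∷ q)  = cong suc (∣p∪q∣ p q)

p△p∪q : ∀ {n} (p q : Subset n) → p △ (p ∪ q) ≡ q ─ p
p△p∪q []          []          = refl
p△p∪q (false ∷ p) (false ∷ q) = cong (false ∷_) (p△p∪q p q)
p△p∪q (false ∷ p) (true ∷ q)  = cong (true ∷_) (p△p∪q p q)
p△p∪q (true ∷ p)  (false ∷ q) = cong (false ∷_) (p△p∪q p q)
p△p∪q (true ∷ p)  (true ∷ q)  = cong (false ∷_) (p△p∪q p q)

p∪q△q : ∀ {n} (p q : Subset n) → (p ∪ q) △ q ≡ p ─ q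
p∪q△q []          []          = refl
p∪q△q (false ∷ p) (false ∷ q) = cong (false ∷_) (p∪q△q p q)
p∪q△q (false ∷ p) (true ∷ q)  = cong (false ∷_) (p∪q△q p q)
p∪q△q (true ∷ p)  (false ∷ q) = cong (true ∷_) (p∪q△q p q)
p∪q△q (true ∷ p)  (true ∷ q)  = cong (false ∷_) (p∪q△q p q)

∉-∪ : ∀ {n} {z : Fin n} {p q} → z ∉ p → z ∉ q → z ∉ p ∪ q
∉-∪ {p = p} {q} z∉p z∉q z∈ with x∈p∪q⁻ p q z∈
... | inj₁ z∈p = z∉p z∈p
... | inj₂ z∈q = z∉q z∈q

⊆⇒≡⊎⊂ : ∀ {n} {p q : Subset n} → p ⊆ q → p ≡ q ⊎ p ⊂ q
⊆⇒≡⊎⊂ {p = p} {q} p⊆q with any? (λ x → x ∈? q ×-dec ¬? (x ∈? p))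
... | yes missing = inj₂ (p⊆q , missing)
... | no none     = inj₁ (⊆-antisym p⊆q q⊆p)
  where
  q⊆p : q ⊆ p
  q⊆p {x} x∈q = decidable-stable (x ∈? p) (λ x∉p → none (x , x∈q , x∉p))

⊆∧∣≡∣⇒≡ : ∀ {n} {p q : Subset n} → p ⊆ q → ∣ p ∣ ≡ ∣ q ∣ → p ≡ q
⊆∧∣≡∣⇒≡ p⊆q ∣p∣≡∣q∣ with ⊆⇒≡⊎⊂ p⊆q
... | inj₁ p≡q = p≡q
... | inj₂ p⊂q = ⊥-elim (<-irrefl ∣p∣≡∣q∣ (p⊂q⇒∣p∣<∣q∣ p⊂q))

⊆∧∣≢∣⇒missing : ∀ {n} {p q : Subset n} → p ⊆ q → ¬ ∣ p ∣ ≡ ∣ q ∣ →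
                ∃ λ x → x ∈ q × x ∉ p
⊆∧∣≢∣⇒missing p⊆q ∣p∣≢∣q∣ with ⊆⇒≡⊎⊂ p⊆q
... | inj₁ refl          = ⊥-elim (∣p∣≢∣q∣ refl)
... | inj₂ (_ , missing) = missing

x∈p─q⇒x∉q : ∀ {n} (p q : Subset n) {z} → z ∈ p ─ q → z ∉ q
x∈p─q⇒x∉q (_ ∷ p) (false ∷ q) (there z∈) (there z∈q) = x∈p─q⇒x∉q p q z∈ z∈q
x∈p─q⇒x∉q (_ ∷ p) (true ∷ q)  (there z∈) (there z∈q) = x∈p─q⇒x∉q p q z∈ z∈q

─≡⁅⁆ : ∀ {n} {p q : Subset n} {y} → y ∈ p → y ∉ q →
       (∀ {z} → z ∈ p → z ≢ y → z ∈ q) → p ─ q ≡ ⁅ y ⁆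
─≡⁅⁆ {p = p} {q} {y} y∈p y∉q others = ⊆-antisym only-y (λ z∈ → y-in (x∈⁅y⁆⇒x≡y y z∈))
  where
  only-y : p ─ q ⊆ ⁅ y ⁆
  only-y {z} z∈ with z ≟ᶠ y
  ... | yes refl = x∈⁅x⁆ y
  ... | no z≢y   = ⊥-elim (x∈p─q⇒x∉q p q z∈ (others (p─q⊆p p q z∈) z≢y))
  y-in : ∀ {z} → z ≡ y → z ∈ p ─ q
  y-in refl = x∈p∧x∉q⇒x∈p─q y∈p y∉q

swap : ∀ {n} → Fin n → Fin n → Subset n → Subset n
swap x y C = delete y (insert x C)

∈-swap⁻ : ∀ {n} {x y z : Fin n} C → z ∈ swap x y C → z ≡ x ⊎ z ∈ C
∈-swap⁻ C = ∈-insert⁻ C ∘ proj₂ ∘ ∈-delete⁻ (insert _ C)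

∣swap∣ : ∀ {n} {x y : Fin n} C → x ∉ C → y ∈ insert x C → ∣ swap x y C ∣ ≡ ∣ C ∣
∣swap∣ {x = x} {y} C x∉C y∈ = sym (suc-injective (trans (sym (∣insert∣ x C x∉C)) (∣delete∣ y _ y∈)))

∉-swap : ∀ {n} {x y z : Fin n} C → z ∉ C → z ≢ x → z ∉ swap x y C
∉-swap C z∉C z≢x z∈ with ∈-swap⁻ C z∈
... | inj₁ z≡x = z≢x z≡x
... | inj₂ z∈C = z∉C z∈C

swap-self⊆ : ∀ {n} (x : Fin n) C → swap x x C ⊆ C
swap-self⊆ x C {z} z∈ with ∈-delete⁻ (insert x C) z∈
... | z≢x , z∈insert with ∈-insert⁻ C z∈insert
...   | inj₁ z≡x = ⊥-elim (z≢x z≡x)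
...   | inj₂ z∈C = z∈C

insert-⊆-swap : ∀ {n} {x y : Fin n} {S C} → S ⊆ C → x ∉ C → y ∈ C → y ∉ S →
                insert x S ⊆ swap x y C
insert-⊆-swap {x = x} {y} {S} {C} S⊆C x∉C y∈C y∉S {z} z∈ with ∈-insert⁻ S z∈
... | inj₁ refl = ∈-update⁺ _ false (λ { refl → x∉C y∈C }) (x∈insert x C)
... | inj₂ z∈S  = ∈-update⁺ _ false (λ { refl → y∉S z∈S }) (⊆insert x C (S⊆C z∈S))

swap-TJAdj : ∀ {n} {x y : Fin n} C → x ∉ C → y ∈ C → TJAdj C (swap x y C)
swap-TJAdj {x = x} {y} C x∉C y∈C =
  sym (∣swap∣ C x∉C y∈insert) ,
  trans (cong ∣_∣ (─≡⁅⁆ y∈C (x∉delete y _) stays)) (∣⁅x⁆∣≡1 y) ,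
  trans (cong ∣_∣ (─≡⁅⁆ x∈swap x∉C comes-from-C)) (∣⁅x⁆∣≡1 x)
  where
  x≢y : x ≢ y
  x≢y refl = x∉C y∈C
  y∈insert : y ∈ insert x C
  y∈insert = ⊆insert x C y∈C
  x∈swap : x ∈ swap x y C
  x∈swap = ∈-update⁺ _ false x≢y (x∈insert x C)
  stays : ∀ {z} → z ∈ C → z ≢ y → z ∈ swap x y C
  stays z∈C z≢y = ∈-update⁺ _ false z≢y (⊆insert x C z∈C)
  comes-from-C : ∀ {z} → z ∈ swap x y C → z ≢ x → z ∈ C
  comes-from-C {z} z∈ z≢x with ∈-swap⁻ C z∈
  ... | inj₁ z≡x = ⊥-elim (z≢x z≡x)
  ... | inj₂ z∈C = z∈C

module Sequences {n : ℕ} (P : Subset n → Set) (R : Subset n → Subset n → Set) where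

  head : ∀ {A B m} → Steps P R A B m → P A
  head (done pA)     = pA
  head (move pA _ _) = pA

  _++_ : ∀ {A B C m m'} → Steps P R A B m → Steps P R B C m' → Steps P R A C (m + m')
  done _      ++ w' = w'
  move p r w  ++ w' = move p r (w ++ w')

  Reconf-trans : ∀ {A B C} → Reconf P R A B → Reconf P R B C → Reconf P R A C
  Reconf-trans (m , w) (m' , w') = m + m' , w ++ w'

  reverse : (∀ {A B} → R A B → R B A) → ∀ {A B m} → Steps P R A B m → Reconf P R B A
  reverse R-sym (done pA)    = 0 , done pA
  reverse R-sym (move pA r w) = Reconf-trans (reverse R-sym w) (1 , move (head w) (R-sym r) (done pA))

open Sequences

TARAdj-sym : ∀ {n} k {A B : Subset n} → TARAdj k A B → TARAdj k B A
TARAdj-sym k {A} {B} (one , bound) =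
  trans (cong ∣_∣ (△-comm B A)) one , subst (_≤ k) (⊔-comm ∣ A ∣ ∣ B ∣) bound

shrink : ∀ {n} (F : Subset n → Set) k {P Q : Subset n} → P ⊆ Q → ∣ Q ∣ ≤ k →
         (∀ {Z} → P ⊆ Z → Z ⊆ Q → F Z) → Reconf F (TARAdj k) Q P
shrink F k {P} P⊆Q ∣Q∣≤k between = go _ refl P⊆Q ∣Q∣≤k between
  where
  go : ∀ d {Q} → ∣ Q ∣ ≡ d → P ⊆ Q → ∣ Q ∣ ≤ k →
       (∀ {Z} → P ⊆ Z → Z ⊆ Q → F Z) → Reconf F (TARAdj k) Q P
  go d {Q} ∣Q∣≡d P⊆Q ∣Q∣≤k between with ⊆⇒≡⊎⊂ P⊆Q
  ... | inj₁ refl = 0 , done (between P⊆Q P⊆Q)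
  go zero    {Q} ∣Q∣≡d P⊆Q ∣Q∣≤k between | inj₂ (_ , x , x∈Q , _) =
    ⊥-elim (1+n≢0 (trans (sym (∣delete∣ x Q x∈Q)) ∣Q∣≡d))
  go (suc d) {Q} ∣Q∣≡d P⊆Q ∣Q∣≤k between | inj₂ (_ , x , x∈Q , x∉P) =
    let ∣Q⁻∣≤k = ≤-trans (p⊆q⇒∣p∣≤∣q∣ (delete⊆ x Q)) ∣Q∣≤k
        (m , w) = go d (suc-injective (trans (sym (∣delete∣ x Q x∈Q)) ∣Q∣≡d))
                    (λ z∈P → ∈-update⁺ Q false (λ { refl → x∉P z∈P }) (P⊆Q z∈P))
                    ∣Q⁻∣≤k (λ P⊆Z Z⊆Q⁻ → between P⊆Z (⊆-trans Z⊆Q⁻ (delete⊆ x Q)))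
    in suc m , move (between P⊆Q (λ z∈ → z∈)) (∣p△delete∣ x Q x∈Q , ⊔-lub ∣Q∣≤k ∣Q⁻∣≤k) w

module Doubling {n : ℕ} (P : Subset n → Set) (R R' : Subset n → Subset n → Set)
  {A B : Subset n}
  (double : ∀ {e} → Steps P R' A B e → Steps P R A B (2 * e))
  (halve  : ∀ {m} → Steps P R A B m → ∃ λ e → Steps P R' A B e × 2 * e ≤ m) where

  dist-double : ∀ d → IsDist P R' A B d → IsDist P R A B (2 * d)
  dist-double d (w , minimal) = double w , λ m w' →
    let (e , w'' , 2e≤m) = halve w' in ≤-trans (*-monoʳ-≤ 2 (minimal e w'')) 2e≤m

  dist-halve : ∀ d → IsDist P R A B d → ∃ λ e → d ≡ 2 * e × IsDist P R' A B e
  dist-halve d (w , minimal) =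
    let (e , w' , 2e≤d) = halve w
        d≡2e = ≤-antisym (minimal (2 * e) (double w')) 2e≤d
    in e , d≡2e , w' , λ m w'' →
         *-cancelˡ-≤ 2 (≤-trans (≤-reflexive (sym d≡2e)) (minimal (2 * m) (double w'')))

-- Accounting in the TAR-to-TJ simulation: 2 · (TJ steps) + (size of the
-- current TAR set) never exceeds (TAR steps) + K.

charge-deletion : ∀ e s t → 2 * e + s ≤ t → 2 * e + suc s ≤ suc t
charge-deletion e s t le = subst (_≤ suc t) (sym (+-suc (2 * e) s)) (s≤s le)

charge-free-insertion : ∀ e s t → 2 * e + suc s ≤ t → 2 * e + s ≤ suc t
charge-free-insertion e s t le =
  ≤-trans (+-monoʳ-≤ (2 * e) (n≤1+n s)) (≤-trans le (n≤1+n t))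

charge-insertion : ∀ e s t → 2 * e + suc s ≤ t → 2 * suc e + s ≤ suc t
charge-insertion e s t le =
  subst (_≤ suc t) (sym (cong (_+ s) (*-suc 2 e))) (s≤s (subst (_≤ t) (+-suc (2 * e) s) le))

charge-undo : ∀ e s t → 2 * e + s ≤ t → 2 * e + s ≤ suc (suc t)
charge-undo e s t le = ≤-trans le (≤-trans (n≤1+n t) (n≤1+n (suc t)))

-- An insertion immediately followed by a deletion, paid by one TJ step.
charge-exchange : ∀ e s t → 2 * e + s ≤ t → 2 * suc e + s ≤ suc (suc t)
charge-exchange e s t le = subst (_≤ suc (suc t)) (sym (cong (_+ s) (*-suc 2 e))) (s≤s (s≤s le))

module Separators {n : ℕ} (G : Graph n) (u v : Fin n) where

  Sep : Subset n → Set
  Sep = IsSeparator G u v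

  reach-anti : ∀ {S S' x y} → S ⊆ S' → Reach G S' x y → Reach G S x y
  reach-anti S⊆S' here            = here
  reach-anti S⊆S' (step r xy z∉S') = step (reach-anti S⊆S' r) xy (z∉S' ∘ S⊆S')

  sep-super : ∀ {T S} → Sep T → T ⊆ S → u ∉ S → v ∉ S → Sep S
  sep-super (_ , _ , no-walk) T⊆S u∉S v∉S = u∉S , v∉S , no-walk ∘ reach-anti T⊆S

  sep-between : ∀ {T Z S} → Sep T → Sep S → T ⊆ Z → Z ⊆ S → Sep Z
  sep-between sepT (u∉S , v∉S , _) T⊆Z Z⊆S = sep-super sepT T⊆Z (u∉S ∘ Z⊆S) (v∉S ∘ Z⊆S)

  sep-swap : ∀ {x y S C} → Sep C → Sep S → x ∈ S → S ⊆ swap x y C → Sep (swap x y C)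
  sep-swap {C = C} (u∉C , v∉C , _) sepS@(u∉S , v∉S , _) x∈S S⊆ =
    sep-super sepS S⊆ (∉-swap C u∉C λ { refl → u∉S x∈S }) (∉-swap C v∉C λ { refl → v∉S x∈S })

  supersets-connected : ∀ k {T X Y} → Sep T → T ⊆ X → T ⊆ Y → Sep X → Sep Y →
                        ∣ X ∣ ≤ k → ∣ Y ∣ ≤ k → Reconf Sep (TARAdj k) X Y
  supersets-connected k sepT T⊆X T⊆Y sepX sepY ∣X∣≤k ∣Y∣≤k =
    Reconf-trans Sep (TARAdj k)
      (shrink Sep k T⊆X ∣X∣≤k (sep-between sepT sepX))
      (reverse Sep (TARAdj k) (λ {A} {B} → TARAdj-sym k {A} {B})
        (proj₂ (shrink Sep k T⊆Y ∣Y∣≤k (sep-between sepT sepY))))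

  overlap-connected : ∀ k {T S S'} → T ⊆ S' ∩ S → Sep T → Sep S → u ∉ S' → v ∉ S' →
                      ∣ S ∣ ≤ k → ∣ S' ∣ ≤ k →
                      Reconf Sep (TARAdj k) S S' × Reconf Sep (TARAdj k) S' S
  overlap-connected k {T} {S} {S'} T⊆S'∩S sepT sepS u∉S' v∉S' ∣S∣≤k ∣S'∣≤k =
    supersets-connected k sepT T⊆S T⊆S' sepS sepS' ∣S∣≤k ∣S'∣≤k ,
    supersets-connected k sepT T⊆S' T⊆S sepS' sepS ∣S'∣≤k ∣S∣≤k
    where
    T⊆S : T ⊆ S
    T⊆S = proj₂ ∘ x∈p∩q⁻ S' S ∘ T⊆S'∩S
    T⊆S' : T ⊆ S'
    T⊆S' = proj₁ ∘ x∈p∩q⁻ S' S ∘ T⊆S'∩S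
    sepS' : Sep S'
    sepS' = sep-super sepT T⊆S' u∉S' v∉S'

  module _ (K : ℕ) where

    -- A TJ step C → C' between separators of size K is the TAR pair
    -- C → C ∪ C' → C', whose middle set has size K + 1.
    tj⇒tar : ∀ {A B e} → ∣ A ∣ ≡ K → Steps Sep TJAdj A B e → Steps Sep (TARAdj (suc K)) A B (2 * e)
    tj⇒tar ∣A∣ (done sepA) = done sepA
    tj⇒tar {A} ∣A∣ (move {B = A'} {m = e} sepA (∣A∣≡∣A'∣ , ∣A─A'∣ , ∣A'─A∣) w) =
      subst (Steps Sep _ A _) (sym (*-suc 2 e))
        (move sepA (to-union , ⊔-lub (m≤n⇒m≤1+n (≤-reflexive ∣A∣)) (≤-reflexive ∣A∪A'∣))
          (move sepA∪A' (from-union , ⊔-lub (≤-reflexive ∣A∪A'∣) (m≤n⇒m≤1+n (≤-reflexive ∣A'∣)))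
            (tj⇒tar ∣A'∣ w)))
      where
      ∣A'∣ : ∣ A' ∣ ≡ K
      ∣A'∣ = trans (sym ∣A∣≡∣A'∣) ∣A∣
      ∣A∪A'∣ : ∣ A ∪ A' ∣ ≡ suc K
      ∣A∪A'∣ = trans (∣p∪q∣ A A') (trans (cong₂ _+_ ∣A∣ ∣A'─A∣) (+-comm K 1))
      to-union : ∣ A △ (A ∪ A') ∣ ≡ 1
      to-union = trans (cong ∣_∣ (p△p∪q A A')) ∣A'─A∣
      from-union : ∣ (A ∪ A') △ A' ∣ ≡ 1
      from-union = trans (cong ∣_∣ (p∪q△q A A')) ∣A─A'∣
      sepA∪A' : Sep (A ∪ A')
      sepA∪A' = sep-super sepA (p⊆p∪q A')
                  (∉-∪ (proj₁ sepA) (proj₁ (head Sep TJAdj w)))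
                  (∉-∪ (proj₁ (proj₂ sepA)) (proj₁ (proj₂ (head Sep TJAdj w))))

    Simulation : Subset n → Subset n → ℕ → ℕ → Set
    Simulation C B s m = ∃ λ e → Steps Sep TJAdj C B e × 2 * e + s ≤ m + K

    mutual
      simulate : ∀ {S B m} C → Steps Sep (TARAdj (suc K)) S B m → S ⊆ C → ∣ C ∣ ≡ K →
                 Sep C → ∣ B ∣ ≡ K → Simulation C B ∣ S ∣ m
      simulate C (done _) S⊆C ∣C∣ sepC ∣B∣ with ⊆∧∣≡∣⇒≡ S⊆C (trans ∣B∣ (sym ∣C∣))
      ... | refl = 0 , done sepC , ≤-reflexive ∣B∣
      simulate {S} C (move _ (one , _) w) S⊆C ∣C∣ sepC ∣B∣ with flip S _ one
      ... | removed x x∈S =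
        let (e , w' , bound) = simulate C w (⊆-trans (delete⊆ x S) S⊆C) ∣C∣ sepC ∣B∣
        in e , w' , subst (λ s → 2 * e + s ≤ _) (sym (∣delete∣ x S x∈S))
                      (charge-deletion e _ _ bound)
      ... | added x x∉S with x ∈? C
      ...   | yes x∈C =
        let (e , w' , bound) = simulate C w (insert-⊆ x∈C S⊆C) ∣C∣ sepC ∣B∣
        in e , w' , charge-free-insertion e ∣ S ∣ _
                      (subst (λ s → 2 * e + s ≤ _) (∣insert∣ x S x∉S) bound)
      ...   | no x∉C with ∣ S ∣ ≟ ∣ C ∣
      ...     | yes ∣S∣≡∣C∣ with ⊆∧∣≡∣⇒≡ S⊆C ∣S∣≡∣C∣
      ...       | refl = simulate-full S x x∉C ∣C∣ sepC ∣B∣ w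
      simulate {S} C (move _ _ w) S⊆C ∣C∣ sepC ∣B∣ | added x x∉S | no x∉C | no ∣S∣≢∣C∣ =
        let (y , y∈C , y∉S) = ⊆∧∣≢∣⇒missing S⊆C ∣S∣≢∣C∣
            step = swap-TJAdj C x∉C y∈C
            S⁺⊆C' = insert-⊆-swap S⊆C x∉C y∈C y∉S
            sepC' = sep-swap sepC (head Sep _ w) (x∈insert x S) S⁺⊆C'
            (e , w' , bound) = simulate (swap x y C) w S⁺⊆C' (trans (sym (proj₁ step)) ∣C∣)
                                 sepC' ∣B∣
        in suc e , move sepC step w' ,
           charge-insertion e ∣ S ∣ _ (subst (λ s → 2 * e + s ≤ _) (∣insert∣ x S x∉S) bound)

      -- The TAR sequence has just inserted x ∉ C into C itself; having size
      -- K + 1 it must next delete some y, and C → C + x - y is one TJ step.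
      simulate-full : ∀ {B m} C x → x ∉ C → ∣ C ∣ ≡ K → Sep C → ∣ B ∣ ≡ K →
                      Steps Sep (TARAdj (suc K)) (insert x C) B m → Simulation C B ∣ C ∣ (suc m)
      simulate-full C x x∉C ∣C∣ sepC ∣B∣ (done _) =
        ⊥-elim (1+n≢n (trans (sym (trans (∣insert∣ x C x∉C) (cong suc ∣C∣))) ∣B∣))
      simulate-full C x x∉C ∣C∣ sepC ∣B∣ (move _ (one , bound) w) with flip (insert x C) _ one
      ... | added y y∉ =
        ⊥-elim (1+n≰n (≤-trans (≤-reflexive (sym too-big)) (≤-trans (m≤n⊔m _ _) bound)))
        where
        too-big : ∣ insert y (insert x C) ∣ ≡ suc (suc K)
        too-big = trans (∣insert∣ y _ y∉) (cong suc (trans (∣insert∣ x C x∉C) (cong suc ∣C∣)))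
      ... | removed y y∈ with y ≟ᶠ x
      ...   | yes refl =
        let (e , w' , bound) = simulate C w (swap-self⊆ x C) ∣C∣ sepC ∣B∣
        in e , w' , charge-undo e _ _ (subst (λ s → 2 * e + s ≤ _) (∣swap∣ C x∉C y∈) bound)
      ...   | no y≢x =
        let y∈C = ∈-update⁻ C true y≢x y∈
            step = swap-TJAdj C x∉C y∈C
            (e , w' , bound) = simulate (swap x y C) w (λ z∈ → z∈) (trans (sym (proj₁ step)) ∣C∣)
                                 (head Sep _ w) ∣B∣
        in suc e , move sepC step w' ,
           charge-exchange e _ _ (subst (λ s → 2 * e + s ≤ _) (∣swap∣ C x∉C y∈) bound)

    tar⇒tj : ∀ {A B m} → ∣ A ∣ ≡ K → ∣ B ∣ ≡ K → Steps Sep (TARAdj (suc K)) A B m →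
             ∃ λ e → Steps Sep TJAdj A B e × 2 * e ≤ m
    tar⇒tj ∣A∣ ∣B∣ w =
      let (e , w' , bound) = simulate _ w (λ z∈ → z∈) ∣A∣ (head Sep _ w) ∣B∣
      in e , w' , +-cancelʳ-≤ K (2 * e) _ (subst (λ s → 2 * e + s ≤ _) ∣A∣ bound)

lemma3 : ∀ {n} (G : Graph n) (u v : Fin n) (k : ℕ) (Sa Sb Sa' Sb' : Subset n) →
    u ≢ v → ¬ Adjacent G u v → 1 ≤ k →
    IsSeparator G u v Sa → IsSeparator G u v Sb → ∣ Sa ∣ ≤ k → ∣ Sb ∣ ≤ k →
    ¬ (Sa ≢ Sb ×
       ((IsMinimalSeparator G u v Sa × ∣ Sa ∣ ≡ k) ⊎ (IsMinimalSeparator G u v Sb × ∣ Sb ∣ ≡ k))) →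
    u ∉ Sa' → v ∉ Sa' → ∣ Sa' ∣ ≡ k ∸ 1 →
    (∃ λ T → T ⊆ Sa' ∩ Sa × IsSeparator G u v T) →
    u ∉ Sb' → v ∉ Sb' → ∣ Sb' ∣ ≡ k ∸ 1 →
    (∃ λ T → T ⊆ Sb' ∩ Sb × IsSeparator G u v T) →
    (TAR G u v Sa Sb k ⇔ TAR G u v Sa' Sb' k)
    × (TAR G u v Sa' Sb' k ⇔ TJ G u v Sa' Sb')
    × (∀ d → IsDistTJ G u v Sa' Sb' d → IsDistTAR G u v k Sa' Sb' (2 * d))
    × (∀ d → IsDistTAR G u v k Sa' Sb' d → ∃ λ e → d ≡ 2 * e × IsDistTJ G u v Sa' Sb' e)
lemma3 G u v zero _ _ _ _ _ _ ()
lemma3 G u v (suc K) Sa Sb Sa' Sb' _ _ _ sepSa sepSb ∣Sa∣≤k ∣Sb∣≤k _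
       u∉Sa' v∉Sa' ∣Sa'∣ (_ , Ta⊆ , sepTa) u∉Sb' v∉Sb' ∣Sb'∣ (_ , Tb⊆ , sepTb) =
  mk⇔ (λ r → proj₂ Sa⇄Sa' ⨾ (r ⨾ proj₁ Sb⇄Sb')) (λ r → proj₁ Sa⇄Sa' ⨾ (r ⨾ proj₂ Sb⇄Sb')) ,
  mk⇔ (λ (_ , w) → let (e , w' , _) = halve w in e , w') (λ (e , w) → 2 * e , double w) ,
  dist-double ,
  dist-halve
  where
  open Separators G u v

  _⨾_ : ∀ {A B C} → TAR G u v A B (suc K) → TAR G u v B C (suc K) → TAR G u v A C (suc K)
  _⨾_ = Reconf-trans Sep (TARAdj (suc K))

  double : ∀ {e} → Steps Sep TJAdj Sa' Sb' e → Steps Sep (TARAdj (suc K)) Sa' Sb' (2 * e)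
  double = tj⇒tar K ∣Sa'∣

  halve : ∀ {m} → Steps Sep (TARAdj (suc K)) Sa' Sb' m →
          ∃ λ e → Steps Sep TJAdj Sa' Sb' e × 2 * e ≤ m
  halve = tar⇒tj K ∣Sa'∣ ∣Sb'∣

  open Doubling Sep (TARAdj (suc K)) TJAdj double halve

  Sa⇄Sa' : TAR G u v Sa Sa' (suc K) × TAR G u v Sa' Sa (suc K)
  Sa⇄Sa' = overlap-connected (suc K) Ta⊆ sepTa sepSa u∉Sa' v∉Sa' ∣Sa∣≤k
             (m≤n⇒m≤1+n (≤-reflexive ∣Sa'∣))
  Sb⇄Sb' : TAR G u v Sb Sb' (suc K) × TAR G u v Sb' Sb (suc K)
  Sb⇄Sb' = overlap-connected (suc K) Tb⊆ sepTb sepSb u∉Sb' v∉Sb' ∣Sb∣≤k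
             (m≤n⇒m≤1+n (≤-reflexive ∣Sb'∣))
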